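{- Let $k>1$ and $\gamma=\Lambda_k^\vee$. Then $z_\gamma=w_k^{ -1}w_{k-1}^{ -1}\cdots w_1^{ -1}$.
   Context: $W$ is the affine Weyl group of type $C_k^{(1)}$, generated by $s_0,\dots,s_k$ with relations $s_i^2=1$; $s_is_j=s_js_i$ if $|i-j|\ne1$; $s_is_{i+1}s_i=s_{i+1}s_is_{i+1}$ for $1\le i\le k-2$; $(s_is_{i+1})^2=(s_{i+1}s_i)^2$ for $i\in\{0,k-1\}$. It acts faithfully by affine maps on $V=\mathbb{R}^k$: $s_i$ swaps $a_i,a_{i+1}$ ($1\le i\le k-1$), $s_k$ negates $a_k$, $s_0\diamond(a_1,\dots,a_k)=(2-a_1,a_2,\dots,a_k)$, with $(uv)\diamond x=u\diamond(v\diamond x)$. For $1\le i\le k+1$, $w_i:=s_{i-1}\cdots s_1s_0$. Fundamental coweights: $\Lambda_i^\vee=2(\epsilon_1+\dots+\epsilon_i)$ for $i<k$, $\Lambda_k^\vee=\epsilon_1+\dots+\epsilon_k$ ($\epsilon_i$ standard basis), spanning $P^\vee$. $t_\gamma$ is translation by $\gamma\in P^\vee$; $W_{\mathrm{ext}}$ is generated by $W$ and all $t_\gamma$; $\Omega$ is the stabilizer in $W_{\mathrm{ext}}$ of $\mathcal{A}_\emptyset=\{1\ge a_1\ge\dots\ge a_k\ge0\}$; each $t\in W_{\mathrm{ext}}$ is uniquely $w\tau$ ($w\in W,\tau\in\Omega$), $\bar t:=w$, and $z_\gamma:=\overline{t_\gamma}^{ -1}\in W$.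
   Formalization: The space V is taken as ℚ^k in place of ℝ^k, so equality in W and the stabilization of the alcove $\mathcal{A}_\emptyset$ are checked on rational points. -}

module Defs where

open import Data.Nat as ℕ using (ℕ; zero; suc; _<?_; _≟_; _∸_)
open import Data.Nat.Properties using (n≤1+n; ≤-trans)
open import Data.Fin as Fin using (Fin; toℕ; fromℕ<; inject≤)
open import Data.List using (List; []; _∷_; _++_; reverse; map; allFin)
open import Data.Rational using (ℚ; 0ℚ; 1ℚ; _+_; _-_; -_; _≤_)
open import Data.Product using (Σ; _×_)
open import Relation.Binary.PropositionalEquality using (_≡_)
open import Relation.Nullary using (yes; no)

-- Points of V = ℚ^k (rational points of ℝ^k), coordinates a_1..a_k
-- stored at indices 0..k-1.
Pt : ℕ → Set
Pt k = Fin k → ℚ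

-- coordinate access by natural-number index (0-based); 0 out of range
at : {k : ℕ} → Pt k → ℕ → ℚ
at {k} x m with m <? k
... | yes p = x (fromℕ< p)
... | no _  = 0ℚ

-- action of the generator s_i (i = toℕ of the argument, 0 ≤ i ≤ k)
-- on a point, computed coordinatewise (m = 0-based coordinate index,
-- i.e. coordinate a_{m+1}).
genCoord : (k : ℕ) → ℕ → Pt k → ℕ → ℚ
genCoord k zero x zero = (1ℚ + 1ℚ) - at x zero
genCoord k zero x (suc m) = at x (suc m)
genCoord k (suc i) x m with suc i ≟ k
... | yes _ with suc m ≟ k
...   | yes _ = - at x m
...   | no _  = at x m
genCoord k (suc i) x m | no _ with m ≟ i
...   | yes _ = at x (suc i)
...   | no _ with m ≟ suc i
...     | yes _ = at x i
...     | no _  = at x m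

gen : {k : ℕ} → Fin (suc k) → Pt k → Pt k
gen {k} i x j = genCoord k (toℕ i) x (toℕ j)

-- Elements of W as words in the generators s_0..s_k;
-- the word s_{i1} s_{i2} ... s_{ir} is the list [i1, ..., ir].
Word : ℕ → Set
Word k = List (Fin (suc k))

act : {k : ℕ} → Word k → Pt k → Pt k
act [] x = x
act (a ∷ w) x = gen a (act w x)

-- group inverse of a word (generators are involutions)
inv : {k : ℕ} → Word k → Word k
inv = reverse

-- equality of elements (W acts faithfully, affine maps are determined
-- by their values on rational points)
_≈W_ : {k : ℕ} → Word k → Word k → Set
_≈W_ {k} u v = (x : Pt k) (j : Fin k) → act u x j ≡ act v x j

-- w_i = s_{i-1} ⋯ s_1 s_0  (1 ≤ i ≤ k+1)
wWord : (k i : ℕ) → i ℕ.≤ suc k → Word k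
wWord k i p = reverse (map (λ j → inject≤ j p) (allFin i))

zProd : (k m : ℕ) → m ℕ.≤ suc k → Word k
zProd k zero p = []
zProd k (suc m) p = inv (wWord k (suc m) p) ++ zProd k m (≤-trans (n≤1+n m) p)

zWord : (k : ℕ) → Word k
zWord k = zProd k k (n≤1+n k)

-- translation t_γ for γ = Λ_k^∨ = ε_1 + ... + ε_k
tLam : {k : ℕ} → Pt k → Pt k
tLam x j = x j + 1ℚ

InAlcove : {k : ℕ} → Pt k → Set
InAlcove {k} x = (at x 0 ≤ 1ℚ)
               × ((m : ℕ) → suc m ℕ.< k → at x (suc m) ≤ at x m)
               × (0ℚ ≤ at x (k ∸ 1))

_≐_ : {k : ℕ} → Pt k → Pt k → Set
x ≐ y = ∀ j → x j ≡ y j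

Stabilizes : {k : ℕ} → (Pt k → Pt k) → Set
Stabilizes {k} f = ((x : Pt k) → InAlcove x → InAlcove (f x))
                 × ((y : Pt k) → InAlcove y → Σ (Pt k) λ x → InAlcove x × (f x ≐ y))

-- w ∈ W is the W-part of t_γ = w τ with τ ∈ Ω, i.e. τ = w⁻¹ t_γ ∈ W_ext
-- stabilizes A_∅.
IsWPartOfTLam : {k : ℕ} → Word k → Set
IsWPartOfTLam w = Stabilizes (λ x → act (inv w) (tLam x))

-- Every element of W acts as x ↦ (±x_{π m} + c_m)_m with π a permutation of the coordinates
-- and every c_m even.  If w⁻¹ t_γ maps the alcove into itself, its values at the vertices 0
-- and (1,…,1) force all signs to be − and all c_m to be 2, and its values at the vertices
-- (1,…,1,0,…,0) force π to be decreasing, i.e. the reversal m ↦ k−1−m.  So w⁻¹ is the map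
-- x ↦ (2 − x_{k−1−m})_m.  The product w_k⁻¹ ⋯ w_1⁻¹ is that map: w_i⁻¹ = s₀ s₁ ⋯ s_{i−1} rotates
-- the first i coordinates and reflects the new first one in 1.  Composed with t_γ it becomes
-- the symmetry x ↦ (1 − x_{k−1−m})_m of the alcove, which settles existence.

module Submission where

open import Defs
open import Data.Empty using (⊥-elim)
open import Data.Fin as Fin using (Fin; toℕ; inject≤)
open import Data.Fin.Properties using (toℕ-fromℕ<; fromℕ<-toℕ; toℕ<n; toℕ-inject≤)
open import Data.List using (List; []; _∷_; _++_; reverse; map; tabulate; allFin)
open import Data.List.Properties using (∷-injectiveˡ; ∷-injectiveʳ; reverse-involutive; map-tabulate; tabulate-cong; map-∘; map-cong)
open import Data.Nat as ℕ using (ℕ; zero; suc; _∸_; _≤_; _<_; _≟_; _<?_; z≤n; s≤s; z<s)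
import Data.Nat.Properties as ℕP
open import Data.Product using (Σ; _×_; _,_; proj₁; proj₂)
open import Data.Rational as ℚ using (ℚ; 0ℚ; 1ℚ; _+_; _-_; -_)
import Data.Rational.Properties as ℚP
open import Data.Rational.Solver using (module +-*-Solver)
open import Data.Sign as Sign using (Sign; opposite)
open import Data.Sum using (_⊎_; inj₁; inj₂)
open import Relation.Nullary using (¬_; yes; no)
open import Relation.Binary.PropositionalEquality
open +-*-Solver using (solve; _:=_; _:+_; _:-_; :-_; con)

private
  variable
    k m n i b : ℕ

mirror : ℕ → ℕ → ℕ
mirror k m = k ∸ suc m

mirror-< : 0 < k → mirror k m < k
mirror-< {suc k} {m} _ = s≤s (ℕP.m∸n≤m k m)

mirror-involutive : m < k → mirror k (mirror k m) ≡ m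
mirror-involutive {k = suc k} (s≤s m≤k) = ℕP.m∸[m∸n]≡n m≤k

suc-mirror-suc : suc m < k → suc (mirror k (suc m)) ≡ mirror k m
suc-mirror-suc {zero}  {suc zero}    (s≤s ())
suc-mirror-suc {zero}  {suc (suc k)} _         = refl
suc-mirror-suc {suc m} {suc k}       (s≤s 2+m≤k) = suc-mirror-suc 2+m≤k

descending⇒mirror : (f : ℕ → ℕ) → (∀ {m} → m < k → f m < k) →
                    (∀ {m} → suc m < k → f (suc m) < f m) → ∀ {m} → m < k → f m ≡ mirror k m
descending⇒mirror {suc k} f f< desc {m} m<k = ℕP.≤-antisym (upper m m<k)
  (subst (λ i → mirror (suc k) m ≤ f i) (mirror-involutive m<k) (lower (mirror (suc k) m) (mirror-< {m = m} z<s)))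
  where
  upper : ∀ m → m < suc k → f m ≤ mirror (suc k) m
  upper zero    0<k   = ℕP.≤-pred (f< 0<k)
  upper (suc m) 1+m<k = ℕP.≤-pred (ℕP.<-≤-trans (desc 1+m<k)
    (subst (f m ≤_) (sym (suc-mirror-suc 1+m<k)) (upper m (ℕP.<⇒≤ 1+m<k))))
  lower : ∀ d → d < suc k → d ≤ f (mirror (suc k) d)
  lower zero    _     = z≤n
  lower (suc d) 1+d<k = ℕP.≤-trans (s≤s (lower d (ℕP.<⇒≤ 1+d<k)))
    (subst (λ i → suc (f i) ≤ f (mirror (suc k) (suc d))) (suc-mirror-suc 1+d<k)
           (desc (subst (_< suc k) (sym (suc-mirror-suc 1+d<k)) (mirror-< {m = d} z<s))))

fromFun : (ℕ → ℚ) → Pt k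
fromFun f j = f (toℕ j)

at-fromFun : (f : ℕ → ℚ) → m < k → at {k} (fromFun f) m ≡ f m
at-fromFun {m} {k} f m<k with m <? k
... | yes p = cong f (toℕ-fromℕ< p)
... | no m≮k = ⊥-elim (m≮k m<k)

at-toℕ : (x : Pt k) (j : Fin k) → at x (toℕ j) ≡ x j
at-toℕ {k} x j with toℕ j <? k
... | yes p = cong x (fromℕ<-toℕ j p)
... | no j≮k = ⊥-elim (j≮k (toℕ<n j))

at-tLam : (y : Pt k) → m < k → at (tLam y) m ≡ at y m + 1ℚ
at-tLam {k} {m} y m<k with m <? k
... | yes _ = refl
... | no m≮k = ⊥-elim (m≮k m<k)

≐-from-at : {x y : Pt k} → (∀ {m} → m < k → at x m ≡ at y m) → x ≐ y
≐-from-at {x = x} {y} x≡y j = trans (sym (at-toℕ x j)) (trans (x≡y (toℕ<n j)) (at-toℕ y j))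

-- The transposition of i and suc i, split into cases exactly as genCoord is, so that
-- genCoord-sᵢ holds clause by clause.
swap : ℕ → ℕ → ℕ
swap i m with m ≟ i
... | yes _ = suc i
... | no _ with m ≟ suc i
...   | yes _ = i
...   | no _  = m

swap-left : ∀ i → swap i i ≡ suc i
swap-left i with i ≟ i
... | yes _  = refl
... | no i≢i = ⊥-elim (i≢i refl)

swap-right : ∀ i → swap i (suc i) ≡ i
swap-right i with suc i ≟ i
... | yes 1+i≡i = ⊥-elim (ℕP.1+n≢n 1+i≡i)
... | no _ with suc i ≟ suc i
...   | yes _ = refl
...   | no ne = ⊥-elim (ne refl)

swap-other : m ≢ i → m ≢ suc i → swap i m ≡ m
swap-other {m} {i} m≢i m≢1+i with m ≟ i
... | yes m≡i = ⊥-elim (m≢i m≡i)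
... | no _ with m ≟ suc i
...   | yes m≡1+i = ⊥-elim (m≢1+i m≡1+i)
...   | no _      = refl

data SwapCase (i : ℕ) : ℕ → Set where
  left  : SwapCase i i
  right : SwapCase i (suc i)
  other : m ≢ i → m ≢ suc i → SwapCase i m

swapCase : ∀ i m → SwapCase i m
swapCase i m with m ≟ i | m ≟ suc i
... | yes refl | _        = left
... | no _     | yes refl = right
... | no m≢i   | no m≢1+i = other m≢i m≢1+i

swap-involutive : ∀ i m → swap i (swap i m) ≡ m
swap-involutive i m with swapCase i m
... | left             = trans (cong (swap i) (swap-left i)) (swap-right i)
... | right            = trans (cong (swap i) (swap-right i)) (swap-left i)
... | other m≢i m≢1+i  = trans (cong (swap i) (swap-other m≢i m≢1+i)) (swap-other m≢i m≢1+i)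

swap-< : suc i < k → m < k → swap i m < k
swap-< {i} {k} {m} 1+i<k m<k with swapCase i m
... | left            = subst (_< k) (sym (swap-left i)) 1+i<k
... | right           = subst (_< k) (sym (swap-right i)) (ℕP.<⇒≤ 1+i<k)
... | other m≢i m≢1+i = subst (_< k) (sym (swap-other m≢i m≢1+i)) m<k

genCoord-sᵢ : (y : Pt k) → suc i ≢ k → ∀ m → genCoord k (suc i) y m ≡ at y (swap i m)
genCoord-sᵢ {k} {i} y 1+i≢k m with suc i ≟ k
... | yes 1+i≡k = ⊥-elim (1+i≢k 1+i≡k)
... | no _ with m ≟ i
...   | yes _ = refl
...   | no _ with m ≟ suc i
...     | yes _ = refl
...     | no _  = refl

genCoord-sₖ-last : (y : Pt (suc i)) → genCoord (suc i) (suc i) y i ≡ - at y i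
genCoord-sₖ-last {i} y with suc i ≟ suc i
... | no ne = ⊥-elim (ne refl)
... | yes _ with suc i ≟ suc i
...   | yes _ = refl
...   | no ne = ⊥-elim (ne refl)

genCoord-sₖ-other : (y : Pt (suc i)) → m ≢ i → genCoord (suc i) (suc i) y m ≡ at y m
genCoord-sₖ-other {i} {m} y m≢i with suc i ≟ suc i
... | no ne = ⊥-elim (ne refl)
... | yes _ with suc m ≟ suc i
...   | yes 1+m≡1+i = ⊥-elim (m≢i (ℕP.suc-injective 1+m≡1+i))
...   | no _        = refl

-- Signs and even rationals

2ℚ : ℚ
2ℚ = 1ℚ + 1ℚ

infixr 7 _·_

_·_ : Sign → ℚ → ℚ
Sign.+ · q = q
Sign.- · q = - q

·-opposite : ∀ s q → opposite s · q ≡ - (s · q)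
·-opposite Sign.+ q = refl
·-opposite Sign.- q = solve 1 (λ q → q := :- (:- q)) refl q

double : ℕ → ℚ
double zero    = 0ℚ
double (suc n) = double n + 2ℚ

Even : ℚ → Set
Even q = Σ Sign λ s → Σ ℕ λ n → q ≡ s · double n

even-0 : Even 0ℚ
even-0 = Sign.+ , 0 , refl

even-neg : ∀ {q} → Even q → Even (- q)
even-neg (s , n , refl) = opposite s , n , sym (·-opposite s (double n))

even-2- : ∀ {q} → Even q → Even (2ℚ - q)
even-2- (Sign.+ , zero  , refl) = Sign.+ , 1 , refl
even-2- (Sign.+ , suc n , refl) =
  Sign.- , n , solve 1 (λ d → (con 1ℚ :+ con 1ℚ) :- (d :+ (con 1ℚ :+ con 1ℚ)) := :- d) refl (double n)
even-2- (Sign.- , n     , refl) =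
  Sign.+ , suc n , solve 1 (λ d → (con 1ℚ :+ con 1ℚ) :- (:- d) := d :+ (con 1ℚ :+ con 1ℚ)) refl (double n)

double-nonneg : ∀ n → 0ℚ ℚ.≤ double n
double-nonneg zero    = ℚP.≤-refl
double-nonneg (suc n) = ℚP.+-mono-≤ (double-nonneg n) (ℚP.≤ᵇ⇒≤ {0ℚ} {2ℚ} _)

even-nonneg-or-≤-2 : ∀ {q} → Even q → 0ℚ ℚ.≤ q ⊎ q ℚ.≤ - 2ℚ
even-nonneg-or-≤-2 (Sign.+ , n     , refl) = inj₁ (double-nonneg n)
even-nonneg-or-≤-2 (Sign.- , zero  , refl) = inj₁ ℚP.≤-refl
even-nonneg-or-≤-2 (Sign.- , suc n , refl) = inj₂ (ℚP.neg-antimono-≤ (ℚP.+-monoˡ-≤ 2ℚ (double-nonneg n)))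

2-[a+1]≡1-a : ∀ a → 2ℚ - (a + 1ℚ) ≡ 1ℚ - a
2-[a+1]≡1-a = solve 1 (λ a → (con 1ℚ :+ con 1ℚ) :- (a :+ con 1ℚ) := con 1ℚ :- a) refl

UnitInterval : ℚ → Set
UnitInterval q = 0ℚ ℚ.≤ q × q ℚ.≤ 1ℚ

-- Evenness of c is what rules out the sign +, which would need c = -1.
forced-sign-shift : ∀ s {c} → Even c → UnitInterval (s · 1ℚ + c) → UnitInterval (s · 2ℚ + c) →
                    s ≡ Sign.- × c ≡ 2ℚ
forced-sign-shift Sign.+ even-c (0≤1+c , _) (_ , 2+c≤1) with even-nonneg-or-≤-2 even-c
... | inj₁ 0≤c  = ⊥-elim (ℚP.≤⇒≤ᵇ (ℚP.≤-trans (ℚP.+-monoʳ-≤ 2ℚ 0≤c) 2+c≤1))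
... | inj₂ c≤-2 = ⊥-elim (ℚP.≤⇒≤ᵇ (ℚP.≤-trans 0≤1+c (ℚP.+-monoʳ-≤ 1ℚ c≤-2)))
forced-sign-shift Sign.- {c} _ (_ , -1+c≤1) (0≤-2+c , _) = refl , ℚP.≤-antisym c≤2 2≤c
  where
  open ℚP.≤-Reasoning
  c≤2 : c ℚ.≤ 2ℚ
  c≤2 = begin
    c                 ≡⟨ solve 1 (λ c → c := (:- con 1ℚ :+ c) :+ con 1ℚ) refl c ⟩
    (- 1ℚ + c) + 1ℚ   ≤⟨ ℚP.+-monoˡ-≤ 1ℚ -1+c≤1 ⟩
    2ℚ                ∎
  2≤c : 2ℚ ℚ.≤ c
  2≤c = begin
    2ℚ                ≤⟨ ℚP.+-monoˡ-≤ 2ℚ 0≤-2+c ⟩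
    (- 2ℚ + c) + 2ℚ   ≡⟨ solve 1 (λ c → (:- (con 1ℚ :+ con 1ℚ) :+ c) :+ (con 1ℚ :+ con 1ℚ) := c) refl c ⟩
    c                 ∎

-- Elements of W as signed permutations

modifyAt : {A : Set} → ℕ → (A → A) → (ℕ → A) → ℕ → A
modifyAt n g f m with m ≟ n
... | yes _ = g (f m)
... | no _  = f m

record SignedPermAffine (k : ℕ) (f : Pt k → Pt k) : Set where
  field
    sign           : ℕ → Sign
    perm           : ℕ → ℕ
    shift          : ℕ → ℚ
    perm-<         : ∀ {m} → m < k → perm m < k
    perm-injective : ∀ {m m′} → m < k → m′ < k → perm m ≡ perm m′ → m ≡ m′
    shift-even     : ∀ m → Even (shift m)
    coord          : ∀ x {m} → m < k → at (f x) m ≡ sign m · at x (perm m) + shift m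

open SignedPermAffine

id-signedPermAffine : SignedPermAffine k (λ x → x)
id-signedPermAffine = record
  { sign = λ _ → Sign.+ ; perm = λ m → m ; shift = λ _ → 0ℚ
  ; perm-< = λ m<k → m<k ; perm-injective = λ _ _ eq → eq ; shift-even = λ _ → even-0
  ; coord = λ x _ → sym (ℚP.+-identityʳ _) }

module _ {f : Pt k → Pt k} (F : SignedPermAffine k f) where

  s₀-signedPermAffine : SignedPermAffine k (λ x → fromFun (genCoord k 0 (f x)))
  s₀-signedPermAffine = record
    { sign = modifyAt 0 opposite (sign F) ; perm = perm F ; shift = modifyAt 0 (λ c → 2ℚ - c) (shift F)
    ; perm-< = perm-< F ; perm-injective = perm-injective F ; shift-even = shift-even′ ; coord = coord′ }
    where
    shift-even′ : ∀ m → Even (modifyAt 0 (λ c → 2ℚ - c) (shift F) m)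
    shift-even′ zero    = even-2- (shift-even F 0)
    shift-even′ (suc m) = shift-even F (suc m)
    coord′ : ∀ x {m} → m < k → at {k} (fromFun (genCoord k 0 (f x))) m
           ≡ modifyAt 0 opposite (sign F) m · at x (perm F m) + modifyAt 0 (λ c → 2ℚ - c) (shift F) m
    coord′ x {zero} 0<k = begin
      at {k} (fromFun (genCoord k 0 (f x))) 0      ≡⟨ at-fromFun (genCoord k 0 (f x)) 0<k ⟩
      2ℚ - at (f x) 0                              ≡⟨ cong (λ c → 2ℚ - c) (coord F x 0<k) ⟩
      2ℚ - (sign F 0 · X + shift F 0)              ≡⟨ solve 3 (λ t a c → t :- (a :+ c) := (:- a) :+ (t :- c))
                                                              refl 2ℚ (sign F 0 · X) (shift F 0) ⟩
      - (sign F 0 · X) + (2ℚ - shift F 0)          ≡⟨ cong (_+ (2ℚ - shift F 0)) (·-opposite (sign F 0) X) ⟨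
      opposite (sign F 0) · X + (2ℚ - shift F 0)   ∎
      where
      open ≡-Reasoning
      X : ℚ
      X = at x (perm F 0)
    coord′ x {suc m} 1+m<k = trans (at-fromFun (genCoord k 0 (f x)) 1+m<k) (coord F x 1+m<k)

  sᵢ-signedPermAffine : suc i < k → SignedPermAffine k (λ x → fromFun (genCoord k (suc i) (f x)))
  sᵢ-signedPermAffine {i} 1+i<k = record
    { sign = λ m → sign F (swap i m) ; perm = λ m → perm F (swap i m) ; shift = λ m → shift F (swap i m)
    ; perm-< = λ m<k → perm-< F (swap-< 1+i<k m<k)
    ; perm-injective = λ {m} {m′} m<k m′<k eq →
        trans (sym (swap-involutive i m))
          (trans (cong (swap i) (perm-injective F (swap-< 1+i<k m<k) (swap-< 1+i<k m′<k) eq))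
                 (swap-involutive i m′))
    ; shift-even = λ m → shift-even F (swap i m)
    ; coord = λ x {m} m<k →
        trans (at-fromFun (genCoord k (suc i) (f x)) m<k)
          (trans (genCoord-sᵢ (f x) (ℕP.<⇒≢ 1+i<k) m) (coord F x (swap-< 1+i<k m<k))) }

sₖ-signedPermAffine : {f : Pt (suc i) → Pt (suc i)} → SignedPermAffine (suc i) f →
                      SignedPermAffine (suc i) (λ x → fromFun (genCoord (suc i) (suc i) (f x)))
sₖ-signedPermAffine {i} {f} F = record
  { sign = modifyAt i opposite (sign F) ; perm = perm F ; shift = modifyAt i -_ (shift F)
  ; perm-< = perm-< F ; perm-injective = perm-injective F ; shift-even = shift-even′ ; coord = coord′ }
  where
  shift-even′ : ∀ m → Even (modifyAt i -_ (shift F) m)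
  shift-even′ m with m ≟ i
  ... | yes _ = even-neg (shift-even F m)
  ... | no _  = shift-even F m
  coord′ : ∀ x {m} → m < suc i → at {suc i} (fromFun (genCoord (suc i) (suc i) (f x))) m
         ≡ modifyAt i opposite (sign F) m · at x (perm F m) + modifyAt i -_ (shift F) m
  coord′ x {m} m<k with m ≟ i
  ... | yes refl = begin
    at {suc i} (fromFun (genCoord (suc i) (suc i) (f x))) i  ≡⟨ at-fromFun (genCoord (suc i) (suc i) (f x)) m<k ⟩
    genCoord (suc i) (suc i) (f x) i                         ≡⟨ genCoord-sₖ-last (f x) ⟩
    - at (f x) i                                             ≡⟨ cong -_ (coord F x m<k) ⟩
    - (sign F i · X + shift F i)                             ≡⟨ ℚP.neg-distrib-+ (sign F i · X) (shift F i) ⟩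
    - (sign F i · X) + - shift F i                           ≡⟨ cong (_+ - shift F i) (·-opposite (sign F i) X) ⟨
    opposite (sign F i) · X + - shift F i                    ∎
    where
    open ≡-Reasoning
    X : ℚ
    X = at x (perm F i)
  ... | no m≢i = trans (at-fromFun (genCoord (suc i) (suc i) (f x)) m<k)
                       (trans (genCoord-sₖ-other (f x) m≢i) (coord F x m<k))

genCoord-signedPermAffine : ∀ {f} i → i < suc k → SignedPermAffine k f →
                            SignedPermAffine k (λ x → fromFun (genCoord k i (f x)))
genCoord-signedPermAffine zero    _ F = s₀-signedPermAffine F
genCoord-signedPermAffine (suc i) 1+i<1+k F with ℕP.m<1+n⇒m<n∨m≡n 1+i<1+k
... | inj₁ 1+i<k = sᵢ-signedPermAffine F 1+i<k
... | inj₂ refl  = sₖ-signedPermAffine F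

act-signedPermAffine : (u : Word k) → SignedPermAffine k (act u)
act-signedPermAffine []      = id-signedPermAffine
act-signedPermAffine (a ∷ u) = genCoord-signedPermAffine (toℕ a) (toℕ<n a) (act-signedPermAffine u)

-- The word w_k⁻¹ ⋯ w_1⁻¹

upFrom : ℕ → ℕ → List ℕ
upFrom b zero    = []
upFrom b (suc n) = b ∷ upFrom (suc b) n

-- g is f with the block of indices b, …, b + n rotated one step to the right.
record BlockRotation (k b n : ℕ) (g f : ℕ → ℚ) : Set where
  field
    below  : ∀ {m} → m < b → g m ≡ f m
    first  : g b ≡ f (b ℕ.+ n)
    inside : ∀ {j} → b ≤ j → j < b ℕ.+ n → g (suc j) ≡ f j
    above  : ∀ {m} → b ℕ.+ n < m → m < k → g m ≡ f m

blockRotation-refl : (f : ℕ → ℚ) → BlockRotation k b 0 f f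
blockRotation-refl {b = b} f = record
  { below  = λ _ → refl
  ; first  = cong f (sym (ℕP.+-identityʳ b))
  ; inside = λ {j} b≤j j<b+0 → ⊥-elim (ℕP.<-irrefl refl (ℕP.<-≤-trans j<b+0 (subst (_≤ j) (sym (ℕP.+-identityʳ b)) b≤j)))
  ; above  = λ _ _ → refl }

blockRotation-swap : ∀ {g h f} → suc b ℕ.+ n < k → BlockRotation k (suc b) n g f →
                     (∀ {m} → m < k → h m ≡ g (swap b m)) → BlockRotation k b (suc n) h f
blockRotation-swap {b} {n} {k} {g} {h} {f} 1+b+n<k G h≡g∘swap = record
  { below = below′ ; first = first′ ; inside = inside′ ; above = above′ }
  where
  open BlockRotation G
  1+b<k : suc b < k
  1+b<k = ℕP.≤-<-trans (s≤s (ℕP.m≤m+n b n)) 1+b+n<k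
  b<k : b < k
  b<k = ℕP.<⇒≤ 1+b<k
  below′ : ∀ {m} → m < b → h m ≡ f m
  below′ {m} m<b = trans (h≡g∘swap (ℕP.<-trans m<b b<k))
    (trans (cong g (swap-other (ℕP.<⇒≢ m<b) (ℕP.<⇒≢ (ℕP.<-trans m<b (ℕP.n<1+n b))))) (below (ℕP.m<n⇒m<1+n m<b)))
  first′ : h b ≡ f (b ℕ.+ suc n)
  first′ = trans (h≡g∘swap b<k) (trans (cong g (swap-left b)) (trans first (cong f (sym (ℕP.+-suc b n)))))
  inside′ : ∀ {j} → b ≤ j → j < b ℕ.+ suc n → h (suc j) ≡ f j
  inside′ {j} b≤j j<b+1+n with ℕP.m≤n⇒m<n∨m≡n b≤j
  ... | inj₂ refl = trans (h≡g∘swap 1+b<k) (trans (cong g (swap-right b)) (below (ℕP.n<1+n b)))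
  ... | inj₁ b<j  = trans (h≡g∘swap 1+j<k)
    (trans (cong g (swap-other (λ 1+j≡b → ℕP.<-asym b<j (subst (j <_) 1+j≡b (ℕP.n<1+n j)))
                               (λ 1+j≡1+b → ℕP.<-irrefl (sym (ℕP.suc-injective 1+j≡1+b)) b<j)))
           (inside b<j (subst (j <_) (ℕP.+-suc b n) j<b+1+n)))
    where
    1+j<k : suc j < k
    1+j<k = ℕP.≤-<-trans (subst (suc j ≤_) (ℕP.+-suc b n) j<b+1+n) 1+b+n<k
  above′ : ∀ {m} → b ℕ.+ suc n < m → m < k → h m ≡ f m
  above′ {m} b+1+n<m m<k = trans (h≡g∘swap m<k)
    (trans (cong g (swap-other (λ m≡b → ℕP.<-irrefl (sym m≡b) (ℕP.≤-<-trans (ℕP.m≤m+n b (suc n)) b+1+n<m))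
                               (λ m≡1+b → ℕP.<-irrefl (sym m≡1+b) (ℕP.≤-<-trans (s≤s (ℕP.m≤m+n b n)) 1+b+n<m′))))
           (above 1+b+n<m′ m<k))
    where
    1+b+n<m′ : suc b ℕ.+ n < m
    1+b+n<m′ = subst (_< m) (ℕP.+-suc b n) b+1+n<m

ascending-blockRotation : ∀ {b n} (l : Word k) → map toℕ l ≡ upFrom (suc b) n → b ℕ.+ n < k →
                          (y : Pt k) → BlockRotation k b n (at (act l y)) (at y)
ascending-blockRotation {n = zero}  []      _          _      y = blockRotation-refl (at y)
ascending-blockRotation {k} {b} {suc n} (c ∷ l) indices b+1+n<k y =
  blockRotation-swap 1+b+n<k (ascending-blockRotation l (∷-injectiveʳ indices) 1+b+n<k y) act-c
  where
  1+b+n<k : suc b ℕ.+ n < k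
  1+b+n<k = subst (_< k) (ℕP.+-suc b n) b+1+n<k
  1+b≢k : suc b ≢ k
  1+b≢k = ℕP.<⇒≢ (ℕP.≤-<-trans (s≤s (ℕP.m≤m+n b n)) 1+b+n<k)
  act-c : ∀ {m} → m < k → at (act (c ∷ l) y) m ≡ at (act l y) (swap b m)
  act-c {m} m<k = begin
    at (act (c ∷ l) y) m              ≡⟨ at-fromFun (genCoord k (toℕ c) (act l y)) m<k ⟩
    genCoord k (toℕ c) (act l y) m     ≡⟨ cong (λ t → genCoord k t (act l y) m) (∷-injectiveˡ indices) ⟩
    genCoord k (suc b) (act l y) m     ≡⟨ genCoord-sᵢ (act l y) 1+b≢k m ⟩
    at (act l y) (swap b m)            ∎
    where open ≡-Reasoning

act-++ : (u v : Word k) (x : Pt k) → act (u ++ v) x ≡ act u (act v x)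
act-++ []      v x = refl
act-++ (a ∷ u) v x = cong (gen a) (act-++ u v x)

upFrom-tabulate : ∀ b n → tabulate {n = n} (λ j → b ℕ.+ toℕ j) ≡ upFrom b n
upFrom-tabulate b zero    = refl
upFrom-tabulate b (suc n) =
  cong₂ _∷_ (ℕP.+-identityʳ b) (trans (tabulate-cong (λ j → ℕP.+-suc b (toℕ j))) (upFrom-tabulate (suc b) n))

-- w_{m+1}^{-1} = s₀ s₁ ⋯ s_m; these are the indices of s₁ ⋯ s_m.
tail-wInv-indices : (p : suc m ≤ suc k) →
                    map toℕ (map (λ j → inject≤ j p) (tabulate {n = m} Fin.suc)) ≡ upFrom 1 m
tail-wInv-indices {m} p = begin
  map toℕ (map (λ j → inject≤ j p) (tabulate Fin.suc)) ≡⟨ map-∘ (tabulate Fin.suc) ⟨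
  map (λ j → toℕ (inject≤ j p)) (tabulate Fin.suc)     ≡⟨ map-cong (λ j → toℕ-inject≤ j p) (tabulate Fin.suc) ⟩
  map toℕ (tabulate Fin.suc)                           ≡⟨ map-tabulate Fin.suc toℕ ⟩
  tabulate (λ j → suc (toℕ j))                         ≡⟨ upFrom-tabulate 1 m ⟩
  upFrom 1 m                                           ∎
  where open ≡-Reasoning

-- g is f with its first n coordinates put in reverse order and reflected in 1.
record ReflectedPrefix (k n : ℕ) (g f : ℕ → ℚ) : Set where
  field
    prefix : ∀ {m} → m < n → g m ≡ 2ℚ - f (mirror n m)
    rest   : ∀ {m} → n ≤ m → m < k → g m ≡ f m

zProd-reflectedPrefix : ∀ n (p : n ≤ suc k) → n ≤ k → (x : Pt k) →
                        ReflectedPrefix k n (at (act (zProd k n p) x)) (at x)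
zProd-reflectedPrefix zero    _ _ x = record { prefix = λ () ; rest = λ _ _ → refl }
zProd-reflectedPrefix {k} (suc n) p n<k x = record { prefix = prefix′ ; rest = rest′ }
  where
  p′ : n ≤ suc k
  p′ = ℕP.≤-trans (ℕP.n≤1+n n) p
  z : Pt k
  z = act (zProd k n p′) x
  open ReflectedPrefix (zProd-reflectedPrefix n p′ (ℕP.<⇒≤ n<k) x)
  wInv tail : Word k
  wInv = map (λ j → inject≤ j p) (allFin (suc n))
  tail = map (λ j → inject≤ j p) (tabulate {n = n} Fin.suc)
  open BlockRotation (ascending-blockRotation {b = 0} tail (tail-wInv-indices p) n<k z)
  y : Pt k
  y = act tail z
  unfold : ∀ {m} → m < k → at (act (zProd k (suc n) p) x) m ≡ genCoord k 0 y m
  unfold {m} m<k = begin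
    at (act (zProd k (suc n) p) x) m                    ≡⟨ cong (λ v → at v m) (act-++ (inv (wWord k (suc n) p)) _ x) ⟩
    at (act (reverse (reverse wInv)) z) m               ≡⟨ cong (λ v → at (act v z) m) (reverse-involutive wInv) ⟩
    at (gen Fin.zero y) m                               ≡⟨ at-fromFun (genCoord k 0 y) m<k ⟩
    genCoord k 0 y m                                    ∎
    where open ≡-Reasoning
  prefix′ : ∀ {m} → m < suc n → at (act (zProd k (suc n) p) x) m ≡ 2ℚ - at x (mirror (suc n) m)
  prefix′ {zero}  _          = trans (unfold (ℕP.≤-<-trans z≤n n<k)) (cong (λ c → 2ℚ - c) (trans first (rest ℕP.≤-refl n<k)))
  prefix′ {suc j} (s≤s j<n) = trans (unfold (ℕP.≤-<-trans j<n n<k)) (trans (inside z≤n j<n) (prefix j<n))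
  rest′ : ∀ {m} → suc n ≤ m → m < k → at (act (zProd k (suc n) p) x) m ≡ at x m
  rest′ {suc j} (s≤s n≤j) m<k = trans (unfold m<k) (trans (above (s≤s n≤j) m<k) (rest (ℕP.m≤n⇒m≤1+n n≤j) m<k))

zWord-coord : (x : Pt k) → m < k → at (act (zWord k) x) m ≡ 2ℚ - at x (mirror k m)
zWord-coord {k} x = ReflectedPrefix.prefix (zProd-reflectedPrefix k (ℕP.n≤1+n k) ℕP.≤-refl x)

1-‿antimono : ∀ {a c} → a ℚ.≤ c → 1ℚ - c ℚ.≤ 1ℚ - a
1-‿antimono a≤c = ℚP.+-monoʳ-≤ 1ℚ (ℚP.neg-antimono-≤ a≤c)

inAlcove-≤1 : {y : Pt k} → InAlcove y → ∀ m → m < k → at y m ℚ.≤ 1ℚ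
inAlcove-≤1 (top , _ , _)      zero    _     = top
inAlcove-≤1 A@(_ , desc , _) (suc m) 1+m<k =
  ℚP.≤-trans (desc m 1+m<k) (inAlcove-≤1 A m (ℕP.<⇒≤ 1+m<k))

inAlcove-mirror-≥0 : {y : Pt k} → 0 < k → InAlcove y → ∀ d → d < k → 0ℚ ℚ.≤ at y (mirror k d)
inAlcove-mirror-≥0 _ (_ , _ , bottom) zero _ = bottom
inAlcove-mirror-≥0 {k} {y} 0<k A@(_ , desc , _) (suc d) 1+d<k =
  ℚP.≤-trans (inAlcove-mirror-≥0 0<k A d (ℕP.<⇒≤ 1+d<k))
             (subst (λ i → at y i ℚ.≤ at y (mirror k (suc d))) (suc-mirror-suc 1+d<k)
                    (desc (mirror k (suc d)) (subst (_< k) (sym (suc-mirror-suc 1+d<k)) (mirror-< 0<k))))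

inAlcove-≥0 : {y : Pt k} → 0 < k → InAlcove y → ∀ m → m < k → 0ℚ ℚ.≤ at y m
inAlcove-≥0 {k} {y} 0<k A m m<k =
  subst (λ i → 0ℚ ℚ.≤ at y i) (mirror-involutive m<k) (inAlcove-mirror-≥0 0<k A (mirror k m) (mirror-< 0<k))

inAlcove-reflect : {x g : Pt k} → 0 < k → InAlcove x →
                   (∀ {m} → m < k → at g m ≡ 1ℚ - at x (mirror k m)) → InAlcove g
inAlcove-reflect {k} {x} {g} 0<k A@(top , desc , bottom) g≡ = top′ , desc′ , bottom′
  where
  top′ : at g 0 ℚ.≤ 1ℚ
  top′ = subst (ℚ._≤ 1ℚ) (sym (g≡ 0<k)) (1-‿antimono bottom)
  desc′ : ∀ m → suc m < k → at g (suc m) ℚ.≤ at g m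
  desc′ m 1+m<k = subst₂ ℚ._≤_ (sym (g≡ 1+m<k)) (sym (g≡ (ℕP.<⇒≤ 1+m<k)))
    (1-‿antimono (subst (λ i → at x i ℚ.≤ at x (mirror k (suc m))) (suc-mirror-suc 1+m<k)
                        (desc (mirror k (suc m)) (subst (_< k) (sym (suc-mirror-suc 1+m<k)) (mirror-< 0<k)))))
  bottom′ : 0ℚ ℚ.≤ at g (k ∸ 1)
  bottom′ = subst (0ℚ ℚ.≤_) (sym (trans (g≡ (mirror-< 0<k)) (cong (λ i → 1ℚ - at x i) (mirror-involutive 0<k))))
                  (1-‿antimono top)

reflection : Pt k → Pt k
reflection {k} x = fromFun (λ m → 1ℚ - at x (mirror k m))

indicator : ℕ → ℕ → ℚ
indicator t j with j <? t
... | yes _ = 1ℚ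
... | no _  = 0ℚ

indicator-< : ∀ {t j} → j < t → indicator t j ≡ 1ℚ
indicator-< {t} {j} j<t with j <? t
... | yes _   = refl
... | no j≮t = ⊥-elim (j≮t j<t)

indicator-≮ : ∀ {t j} → ¬ j < t → indicator t j ≡ 0ℚ
indicator-≮ {t} {j} j≮t with j <? t
... | yes j<t = ⊥-elim (j≮t j<t)
... | no _    = refl

0≤indicator : ∀ t j → 0ℚ ℚ.≤ indicator t j
0≤indicator t j with j <? t
... | yes _ = ℚP.≤ᵇ⇒≤ {0ℚ} {1ℚ} _
... | no _  = ℚP.≤-refl

indicator≤1 : ∀ t j → indicator t j ℚ.≤ 1ℚ
indicator≤1 t j with j <? t
... | yes _ = ℚP.≤-refl
... | no _  = ℚP.≤ᵇ⇒≤ {0ℚ} {1ℚ} _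

indicator-antitone : ∀ t j → indicator t (suc j) ℚ.≤ indicator t j
indicator-antitone t j with suc j <? t
... | yes 1+j<t = ℚP.≤-reflexive (sym (indicator-< (ℕP.<⇒≤ 1+j<t)))
... | no _      = 0≤indicator t j

-- The vertices of the alcove are (1,…,1,0,…,0) with t ones, 0 ≤ t ≤ k.
vertex : ℕ → Pt k
vertex t = fromFun (indicator t)

at-vertex : ∀ t {m} → m < k → at (vertex {k} t) m ≡ indicator t m
at-vertex t = at-fromFun (indicator t)

vertex-inAlcove : 0 < k → ∀ t → InAlcove (vertex {k} t)
vertex-inAlcove {k} 0<k t = top , desc , bottom
  where
  top : at (vertex {k} t) 0 ℚ.≤ 1ℚ
  top = subst (ℚ._≤ 1ℚ) (sym (at-vertex t 0<k)) (indicator≤1 t 0)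
  desc : ∀ m → suc m < k → at (vertex {k} t) (suc m) ℚ.≤ at (vertex {k} t) m
  desc m 1+m<k = subst₂ ℚ._≤_ (sym (at-vertex t 1+m<k)) (sym (at-vertex t (ℕP.<⇒≤ 1+m<k)))
                        (indicator-antitone t m)
  bottom : 0ℚ ℚ.≤ at (vertex {k} t) (k ∸ 1)
  bottom = subst (0ℚ ℚ.≤_) (sym (at-vertex t (mirror-< 0<k))) (0≤indicator t (k ∸ 1))

-- Existence and uniqueness

zWord-tLam-coord : 0 < k → (x : Pt k) → m < k → at (act (zWord k) (tLam x)) m ≡ 1ℚ - at x (mirror k m)
zWord-tLam-coord {k} {m} 0<k x m<k = begin
  at (act (zWord k) (tLam x)) m     ≡⟨ zWord-coord (tLam x) m<k ⟩
  2ℚ - at (tLam x) (mirror k m)     ≡⟨ cong (λ c → 2ℚ - c) (at-tLam x (mirror-< 0<k)) ⟩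
  2ℚ - (at x (mirror k m) + 1ℚ)     ≡⟨ 2-[a+1]≡1-a (at x (mirror k m)) ⟩
  1ℚ - at x (mirror k m)            ∎
  where open ≡-Reasoning

zWord-stabilizes : 0 < k → Stabilizes (λ x → act (zWord k) (tLam x))
zWord-stabilizes {k} 0<k = (λ x A → inAlcove-reflect 0<k A (zWord-tLam-coord 0<k x)) , onto
  where
  onto : (y : Pt k) → InAlcove y → Σ (Pt k) λ x → InAlcove x × (act (zWord k) (tLam x) ≐ y)
  onto y A = reflection y , inAlcove-reflect 0<k A at-reflection , ≐-from-at reflected-twice
    where
    at-reflection : ∀ {m} → m < k → at (reflection y) m ≡ 1ℚ - at y (mirror k m)
    at-reflection = at-fromFun (λ m → 1ℚ - at y (mirror k m))
    reflected-twice : ∀ {m} → m < k → at (act (zWord k) (tLam (reflection y))) m ≡ at y m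
    reflected-twice {m} m<k = begin
      at (act (zWord k) (tLam (reflection y))) m        ≡⟨ zWord-tLam-coord 0<k (reflection y) m<k ⟩
      1ℚ - at (reflection y) (mirror k m)               ≡⟨ cong (λ c → 1ℚ - c) (at-reflection (mirror-< 0<k)) ⟩
      1ℚ - (1ℚ - at y (mirror k (mirror k m)))          ≡⟨ cong (λ i → 1ℚ - (1ℚ - at y i)) (mirror-involutive m<k) ⟩
      1ℚ - (1ℚ - at y m)                                ≡⟨ solve 1 (λ a → con 1ℚ :- (con 1ℚ :- a) := a) refl (at y m) ⟩
      at y m                                            ∎
      where open ≡-Reasoning

existence : 0 < k → Σ (Word k) λ w → IsWPartOfTLam w × (inv w ≈W zWord k)
existence {k} 0<k = reverse (zWord k) , stabilizes , λ x j → cong (λ v → act v x j) (reverse-involutive (zWord k))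
  where
  stabilizes : IsWPartOfTLam (reverse (zWord k))
  stabilizes = subst (λ v → Stabilizes (λ x → act v (tLam x))) (sym (reverse-involutive (zWord k))) (zWord-stabilizes 0<k)

module _ {k : ℕ} (0<k : 0 < k) (u : Word k)
         (preserves : ∀ x → InAlcove x → InAlcove (act u (tLam x))) where

  private
    S : SignedPermAffine k (act u)
    S = act-signedPermAffine u

  tLam-image-coord : ∀ x {m} → m < k →
    at (act u (tLam x)) m ≡ sign S m · (at x (perm S m) + 1ℚ) + shift S m
  tLam-image-coord x {m} m<k = trans (coord S (tLam x) m<k)
    (cong (λ a → sign S m · a + shift S m) (at-tLam x (perm-< S m<k)))

  vertex-image-unit : ∀ t {m} → m < k → UnitInterval (at (act u (tLam (vertex t))) m)
  vertex-image-unit t {m} m<k = inAlcove-≥0 0<k image m m<k , inAlcove-≤1 image m m<k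
    where
    image : InAlcove (act u (tLam (vertex t)))
    image = preserves (vertex t) (vertex-inAlcove 0<k t)

  -- Evaluate at the vertices 0 and (1,…,1).
  sign-shift : ∀ {m} → m < k → sign S m ≡ Sign.- × shift S m ≡ 2ℚ
  sign-shift {m} m<k = forced-sign-shift (sign S m) (shift-even S m)
    (subst UnitInterval (vertex-coord 0 (indicator-≮ {0} {perm S m} λ ())) (vertex-image-unit 0 m<k))
    (subst UnitInterval (vertex-coord k (indicator-< (perm-< S m<k))) (vertex-image-unit k m<k))
    where
    vertex-coord : ∀ t {a} → indicator t (perm S m) ≡ a →
                   at (act u (tLam (vertex t))) m ≡ sign S m · (a + 1ℚ) + shift S m
    vertex-coord t refl = trans (tLam-image-coord (vertex t) m<k)
      (cong (λ a → sign S m · (a + 1ℚ) + shift S m) (at-vertex t (perm-< S m<k)))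

  image-coord : ∀ x {m} → m < k → at (act u x) m ≡ 2ℚ - at x (perm S m)
  image-coord x {m} m<k = begin
    at (act u x) m                            ≡⟨ coord S x m<k ⟩
    sign S m · at x (perm S m) + shift S m    ≡⟨ cong₂ (λ s c → s · at x (perm S m) + c) sign≡- shift≡2 ⟩
    - at x (perm S m) + 2ℚ                    ≡⟨ ℚP.+-comm (- at x (perm S m)) 2ℚ ⟩
    2ℚ - at x (perm S m)                      ∎
    where
    open ≡-Reasoning
    sign≡- : sign S m ≡ Sign.-
    sign≡- = proj₁ (sign-shift m<k)
    shift≡2 : shift S m ≡ 2ℚ
    shift≡2 = proj₂ (sign-shift m<k)

  vertex-image-coord : ∀ t {m} → m < k → at (act u (tLam (vertex t))) m ≡ 1ℚ - indicator t (perm S m)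
  vertex-image-coord t {m} m<k = begin
    at (act u (tLam (vertex t))) m               ≡⟨ image-coord (tLam (vertex t)) m<k ⟩
    2ℚ - at (tLam (vertex {k} t)) (perm S m)     ≡⟨ cong (λ a → 2ℚ - a) (at-tLam (vertex t) (perm-< S m<k)) ⟩
    2ℚ - (at (vertex {k} t) (perm S m) + 1ℚ)     ≡⟨ cong (λ a → 2ℚ - (a + 1ℚ)) (at-vertex t (perm-< S m<k)) ⟩
    2ℚ - (indicator t (perm S m) + 1ℚ)           ≡⟨ 2-[a+1]≡1-a (indicator t (perm S m)) ⟩
    1ℚ - indicator t (perm S m)                  ∎
    where open ≡-Reasoning

  -- At the vertex with perm (suc m) ones the image is 1 at suc m, hence also at m, where it is
  -- 1 − [perm m < perm (suc m)].
  perm-descending : ∀ {m} → suc m < k → perm S (suc m) < perm S m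
  perm-descending {m} 1+m<k with perm S m <? perm S (suc m)
  ... | no πm≮π1+m =
    ℕP.≤∧≢⇒< (ℕP.≮⇒≥ πm≮π1+m) (λ eq → ℕP.1+n≢n (perm-injective S 1+m<k (ℕP.<⇒≤ 1+m<k) eq))
  ... | yes πm<π1+m = ⊥-elim (ℚP.≤⇒≤ᵇ (subst₂ ℚ._≤_ image-at-1+m image-at-m (proj₁ (proj₂ image) m 1+m<k)))
    where
    t : ℕ
    t = perm S (suc m)
    image : InAlcove (act u (tLam (vertex t)))
    image = preserves (vertex t) (vertex-inAlcove 0<k t)
    image-at-1+m : at (act u (tLam (vertex t))) (suc m) ≡ 1ℚ
    image-at-1+m = trans (vertex-image-coord t 1+m<k) (cong (λ a → 1ℚ - a) (indicator-≮ {t} {t} (ℕP.<-irrefl refl)))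
    image-at-m : at (act u (tLam (vertex t))) m ≡ 0ℚ
    image-at-m = trans (vertex-image-coord t (ℕP.<⇒≤ 1+m<k)) (cong (λ a → 1ℚ - a) (indicator-< πm<π1+m))

  alcove-preserving⇒≈zWord : u ≈W zWord k
  alcove-preserving⇒≈zWord x = ≐-from-at λ {m} m<k → begin
    at (act u x) m                ≡⟨ image-coord x m<k ⟩
    2ℚ - at x (perm S m)          ≡⟨ cong (λ i → 2ℚ - at x i) (descending⇒mirror (perm S) (perm-< S) perm-descending m<k) ⟩
    2ℚ - at x (mirror k m)        ≡⟨ zWord-coord x m<k ⟨
    at (act (zWord k) x) m        ∎
    where open ≡-Reasoning

lemma3p11 : (k : ℕ) → 1 < k →
    (Σ (Word k) λ w → IsWPartOfTLam w × (inv w ≈W zWord k))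
    × ((w : Word k) → IsWPartOfTLam w → inv w ≈W zWord k)
lemma3p11 k 1<k = existence 0<k , λ w w-part → alcove-preserving⇒≈zWord 0<k (inv w) (proj₁ w-part)
  where
  0<k : 0 < k
  0<k = ℕP.<-trans z<s 1<k
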